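{- If $A$ is an alternating sign matrix that classically avoids $321$, then every ASM obtained at any stage during the computation of the SW key of $A$ (i.e. after any sequence of removals of removable $-1$ entries) also classically avoids $321$.
   Context: An alternating sign matrix (ASM) of size $n$ is an $n\times n$ matrix with entries in $\{0,1,-1\}$ such that every row and every column sums to $1$ and the nonzero entries of each row and of each column alternate in sign. Position $(i,j)$ is the $i$-th row from the top and $j$-th column from the left. A matrix classically contains $321$ if there are entries equal to $1$ at positions $(x_1,y_3),(x_2,y_2),(x_3,y_1)$ with $x_1<x_2<x_3$ and $y_1<y_2<y_3$ ($-1$ entries are treated as $0$); otherwise it classically avoids $321$. SW key process: a $-1$ entry is removable if no other $-1$ entry lies weakly southwest of it. For a removable $-1$ at $(i,j)$, let $(i,j_0)$ be the nearest $1$ to its west in its row and $(i_0,j)$ the nearest $1$ below it in its column; its neighboring $1$s are the $1$ entries weakly southwest of it such that no other $1$ entry lies both weakly northeast of them and weakly southwest of the $-1$. Consider the $1$s at $(i,j_0)$, $(i_0,j)$ and the neighboring $1$s lying in the rectangle of rows $i..i_0$ and columns $j_0..j$. Replace the south-most of these $1$s by $0$; then moving east to west, for each subsequent one of these $1$s, in column $c$ say, place a new $1$ in the row of the previously replaced $1$ and column $c$, and replace the old $1$ in column $c$ by $0$; finally replace the $-1$ by $0$. Repeating until no $-1$ remains yields a permutation matrix (the SW key of $A$). -}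

module Defs where

open import Data.Nat using (ℕ)
open import Data.Integer using (ℤ; +_; -_; _+_; 0ℤ; 1ℤ; -1ℤ)
import Data.Integer.Properties as ℤP
open import Data.Fin using (Fin; _<_; _≤_)
open import Data.List using (List; []; _∷_; map; foldr; filter)
open import Data.List using () renaming (allFin to allFinL)
open import Data.Product using (_×_; Σ; ∃; ∃-syntax; _,_)
open import Data.Sum using (_⊎_)
open import Relation.Nullary using (¬_; ¬?)
open import Relation.Binary.PropositionalEquality using (_≡_; _≢_)
open import Relation.Binary.Construct.Closure.ReflexiveTransitive using (Star)

-- An n×n integer matrix; position (i , j) = row i (from top), column j (from left).
Matrix : ℕ → Set
Matrix n = Fin n → Fin n → ℤ

sumℤ : List ℤ → ℤ
sumℤ = foldr _+_ 0ℤ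

row : ∀ {n} → Matrix n → Fin n → List ℤ
row A i = map (A i) (allFinL _)

col : ∀ {n} → Matrix n → Fin n → List ℤ
col A j = map (λ i → A i j) (allFinL _)

nonzeros : List ℤ → List ℤ
nonzeros = filter (λ x → ¬? (x ℤP.≟ 0ℤ))

-- consecutive entries alternate in sign (entries are ±1 here)
Alternating : List ℤ → Set
Alternating []            = Data.Unit.⊤ where import Data.Unit
Alternating (x ∷ [])      = Data.Unit.⊤ where import Data.Unit
Alternating (x ∷ y ∷ xs)  = (y ≡ - x) × Alternating (y ∷ xs)

IsASM : ∀ {n} → Matrix n → Set
IsASM {n} A =
  (∀ i j → A i j ≡ 0ℤ ⊎ (A i j ≡ 1ℤ ⊎ A i j ≡ -1ℤ)) ×
  (∀ i → sumℤ (row A i) ≡ 1ℤ) ×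
  (∀ j → sumℤ (col A j) ≡ 1ℤ) ×
  (∀ i → Alternating (nonzeros (row A i))) ×
  (∀ j → Alternating (nonzeros (col A j)))

-- classical containment of 321 (only entries equal to 1 count)
Contains321 : ∀ {n} → Matrix n → Set
Contains321 {n} A =
  ∃[ x₁ ] ∃[ x₂ ] ∃[ x₃ ] ∃[ y₁ ] ∃[ y₂ ] ∃[ y₃ ]
    (x₁ < x₂) × (x₂ < x₃) × (y₁ < y₂) × (y₂ < y₃) ×
    (A x₁ y₃ ≡ 1ℤ) × (A x₂ y₂ ≡ 1ℤ) × (A x₃ y₁ ≡ 1ℤ)

Avoids321 : ∀ {n} → Matrix n → Set
Avoids321 A = ¬ Contains321 A

-- (a , b) lies weakly southwest of (i , j): row a ≥ i (south), column b ≤ j (west)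
WeaklySW : ∀ {n} → Fin n → Fin n → Fin n → Fin n → Set
WeaklySW a b i j = (i ≤ a) × (b ≤ j)

Removable : ∀ {n} → Matrix n → Fin n → Fin n → Set
Removable A i j =
  (A i j ≡ -1ℤ) ×
  (∀ a b → WeaklySW a b i j → ¬ (a ≡ i × b ≡ j) → A a b ≢ -1ℤ)

NearestWest : ∀ {n} → Matrix n → Fin n → Fin n → Fin n → Set
NearestWest A i j j₀ =
  (j₀ < j) × (A i j₀ ≡ 1ℤ) × (∀ c → j₀ < c → c < j → A i c ≢ 1ℤ)

NearestSouth : ∀ {n} → Matrix n → Fin n → Fin n → Fin n → Set
NearestSouth A i j i₀ =
  (i < i₀) × (A i₀ j ≡ 1ℤ) × (∀ r → i < r → r < i₀ → A r j ≢ 1ℤ)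

Neighbor : ∀ {n} → Matrix n → Fin n → Fin n → Fin n → Fin n → Set
Neighbor A i j a b =
  (A a b ≡ 1ℤ) × WeaklySW a b i j ×
  (∀ c d → A c d ≡ 1ℤ → ¬ (c ≡ a × d ≡ b) →
     WeaklySW a b c d → WeaklySW c d i j → Data.Empty.⊥)
  where import Data.Empty

Involved : ∀ {n} → Matrix n → (i j i₀ j₀ : Fin n) → Fin n → Fin n → Set
Involved A i j i₀ j₀ x y =
  (x ≡ i × y ≡ j₀) ⊎ ((x ≡ i₀ × y ≡ j) ⊎
  (Neighbor A i j x y × (i ≤ x) × (x ≤ i₀) × (j₀ ≤ y) × (y ≤ j)))

-- (x , y) receives a new 1: there is an involved 1 in column y, and x is the
-- row of the previously replaced involved 1, i.e. the involved 1 in the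
-- nearest column c > y containing an involved 1 (the process runs east to west).
NewOne : ∀ {n} → Matrix n → (i j i₀ j₀ : Fin n) → Fin n → Fin n → Set
NewOne A i j i₀ j₀ x y =
  (∃[ r ] Involved A i j i₀ j₀ r y) ×
  (∃[ c ] (y < c) × Involved A i j i₀ j₀ x c ×
     (∀ r d → y < d → d < c → ¬ Involved A i j i₀ j₀ r d))

SWStep : ∀ {n} → Matrix n → Matrix n → Set
SWStep {n} A B =
  ∃[ i ] ∃[ j ] ∃[ i₀ ] ∃[ j₀ ]
    Removable A i j × NearestWest A i j j₀ × NearestSouth A i j i₀ ×
    (B i j ≡ 0ℤ) ×
    (∀ x y → NewOne A i j i₀ j₀ x y → B x y ≡ 1ℤ) ×
    (∀ x y → Involved A i j i₀ j₀ x y → ¬ NewOne A i j i₀ j₀ x y → B x y ≡ 0ℤ) ×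
    (∀ x y → ¬ (x ≡ i × y ≡ j) → ¬ Involved A i j i₀ j₀ x y →
       ¬ NewOne A i j i₀ j₀ x y → B x y ≡ A x y)

SWReachable : ∀ {n} → Matrix n → Matrix n → Set
SWReachable = Star SWStep

{-# OPTIONS --safe #-}
-- The neighbors of a removable -1 are the maximal 1s, for the weakly-northeast order, among
-- the 1s weakly southwest of it.  So they form an antichain, i.e. a chain running from
-- northwest to southeast, and every 1 weakly southwest of the -1 lies weakly southwest of
-- one of them.  A removal step deletes the involved 1s of this chain and puts new 1s at its
-- southwest corners.  Two new 1s never form a 21.  The box between consecutive involved 1s
-- contains no 1, so a new 1 strictly southwest of an old 1 can be traded for an old 1
-- strictly southwest of that one and weakly northeast of the new one.  Hence a 321 after the
-- step yields a 321 before it.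
module Submission where

open import Defs
open import Data.Nat.Base as ℕ using (ℕ; _+_; _∸_)
import Data.Nat.Properties as ℕ
open import Data.Nat.Induction using (<-wellFounded)
open import Data.Fin.Base using (Fin; toℕ; _<_; _≤_)
open import Data.Fin.Properties
  using (_≟_; _<?_; ≤-refl; ≤-trans; ≤-antisym; ≤∧≢⇒<; <-irrefl; toℕ≤n)
open import Data.Integer.Base using (0ℤ; 1ℤ; -1ℤ)
open import Data.Product.Base using (_×_; ∃; ∃₂; _,_; proj₁; proj₂)
open import Data.Sum.Base using (_⊎_; inj₁; inj₂; [_,_])
open import Data.Empty using (⊥; ⊥-elim)
open import Function.Base using (id; _∘_)
open import Induction.WellFounded using (Acc; acc)
open import Relation.Nullary.Negation using (¬_; ¬¬-map)
open import Relation.Nullary.Decidable using (yes; no; _×-dec_; ¬¬-excluded-middle)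
open import Relation.Binary.PropositionalEquality using (_≡_; _≢_; refl; sym; trans)
open import Relation.Binary.Construct.Closure.ReflexiveTransitive using (fold)

private
  1≢0 : 1ℤ ≢ 0ℤ
  1≢0 ()

  1≢-1 : 1ℤ ≢ -1ℤ
  1≢-1 ()

weaklySW-trans : ∀ {n} {a b c d e f : Fin n} →
  WeaklySW a b c d → WeaklySW c d e f → WeaklySW a b e f
weaklySW-trans (c≤a , b≤d) (e≤c , d≤f) = ≤-trans e≤c c≤a , ≤-trans b≤d d≤f

swRank : ∀ {n} → Fin n → Fin n → ℕ
swRank {n} r c = toℕ r + (n ∸ toℕ c)

swRank-decreasing : ∀ {n} {r c r′ c′ : Fin n} →
  WeaklySW r c r′ c′ → ¬ (r′ ≡ r × c′ ≡ c) → swRank r′ c′ ℕ.< swRank r c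
swRank-decreasing {n} {r} {r′ = r′} {c′ = c′} (r′≤r , c≤c′) distinct with r′ ≟ r
... | no r′≢r = ℕ.+-mono-<-≤ (≤∧≢⇒< r′≤r r′≢r) (ℕ.∸-monoʳ-≤ n c≤c′)
... | yes refl =
  ℕ.+-monoʳ-< (toℕ r) (ℕ.∸-monoʳ-< (≤∧≢⇒< c≤c′ λ { refl → distinct (refl , refl) }) (toℕ≤n c′))

module _ {n : ℕ} (P : Fin n → Fin n → Set) where

  Dominated : Fin n → Fin n → Set
  Dominated a b = ∃₂ λ c d → P c d × ¬ (c ≡ a × d ≡ b) × WeaklySW a b c d

  Maximal : Fin n → Fin n → Set
  Maximal a b = P a b × ¬ Dominated a b

  weaklySW-of-maximal : ∀ {r c} → P r c →
    ¬ ¬ ∃₂ λ a b → Maximal a b × WeaklySW r c a b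
  weaklySW-of-maximal = climb (<-wellFounded _)
    where
    climb : ∀ {r c} → Acc ℕ._<_ (swRank r c) → P r c →
      ¬ ¬ ∃₂ λ a b → Maximal a b × WeaklySW r c a b
    climb {r} {c} (acc rs) p k = ¬¬-excluded-middle {A = Dominated r c} λ where
      (yes (r′ , c′ , p′ , distinct , sw)) →
        climb (rs (swRank-decreasing sw distinct)) p′
          λ (a , b , max , sw′) → k (a , b , max , weaklySW-trans sw sw′)
      (no undominated) → k (r , c , (p , undominated) , ≤-refl , ≤-refl)

module _ {n : ℕ} {A : Matrix n} {i j : Fin n} where

  weaklyNE-neighbor : ∀ {p q} → A p q ≡ 1ℤ → WeaklySW p q i j →
    ¬ ¬ ∃₂ λ a b → Neighbor A i j a b × WeaklySW p q a b
  weaklyNE-neighbor Apq sw =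
    ¬¬-map (λ (a , b , max , sw′) → a , b , maximal⇒neighbor max , sw′)
      (weaklySW-of-maximal OneSW (Apq , sw))
    where
    OneSW : Fin n → Fin n → Set
    OneSW a b = A a b ≡ 1ℤ × WeaklySW a b i j

    maximal⇒neighbor : ∀ {a b} → Maximal OneSW a b → Neighbor A i j a b
    maximal⇒neighbor ((Aab , sw) , undominated) =
      Aab , sw , λ c d Acd distinct sw′ swij → undominated (c , d , (Acd , swij) , distinct , sw′)

  neighbor-antichain : ∀ {a b a′ b′} → Neighbor A i j a b → Neighbor A i j a′ b′ →
    a ≤ a′ → b′ ≤ b → a ≡ a′ × b ≡ b′
  neighbor-antichain {a} {b} {a′} {b′} (Aab , sw , _) (_ , _ , maximal′) a≤a′ b′≤b
    with (a ≟ a′) ×-dec (b ≟ b′)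
  ... | yes equal = equal
  ... | no distinct = ⊥-elim (maximal′ a b Aab distinct (a≤a′ , b′≤b) sw)

  neighbor-row<⇒col< : ∀ {a b a′ b′} → Neighbor A i j a b → Neighbor A i j a′ b′ →
    a < a′ → b < b′
  neighbor-row<⇒col< {b = b} {b′ = b′} nb nb′ a<a′ with b <? b′
  ... | yes b<b′ = b<b′
  ... | no b≮b′ =
    ⊥-elim (<-irrefl (proj₁ (neighbor-antichain nb nb′ (ℕ.<⇒≤ a<a′) (ℕ.≮⇒≥ b≮b′))) a<a′)

  neighbor-col<⇒row< : ∀ {a b a′ b′} → Neighbor A i j a b → Neighbor A i j a′ b′ →
    b < b′ → a < a′
  neighbor-col<⇒row< {a} {a′ = a′} nb nb′ b<b′ with a <? a′
  ... | yes a<a′ = a<a′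
  ... | no a≮a′ =
    ⊥-elim (<-irrefl (sym (proj₂ (neighbor-antichain nb′ nb (ℕ.≮⇒≥ a≮a′) (ℕ.<⇒≤ b<b′)))) b<b′)

  nearestWest⇒neighbor : ∀ {j₀} → A i j ≡ -1ℤ → NearestWest A i j j₀ → Neighbor A i j i j₀
  nearestWest⇒neighbor {j₀} Aij (j₀<j , Aij₀ , gap) = Aij₀ , (≤-refl , ℕ.<⇒≤ j₀<j) , maximal
    where
    maximal : ∀ c d → A c d ≡ 1ℤ → ¬ (c ≡ i × d ≡ j₀) →
      WeaklySW i j₀ c d → WeaklySW c d i j → ⊥
    maximal c d Acd distinct (c≤i , j₀≤d) (i≤c , d≤j) with ≤-antisym c≤i i≤c
    ... | refl = gap d (≤∧≢⇒< j₀≤d λ { refl → distinct (refl , refl) })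
                       (≤∧≢⇒< d≤j λ { refl → 1≢-1 (trans (sym Acd) Aij) }) Acd

  nearestSouth⇒neighbor : ∀ {i₀} → A i j ≡ -1ℤ → NearestSouth A i j i₀ → Neighbor A i j i₀ j
  nearestSouth⇒neighbor {i₀} Aij (i<i₀ , Ai₀j , gap) = Ai₀j , (ℕ.<⇒≤ i<i₀ , ≤-refl) , maximal
    where
    maximal : ∀ c d → A c d ≡ 1ℤ → ¬ (c ≡ i₀ × d ≡ j) →
      WeaklySW i₀ j c d → WeaklySW c d i j → ⊥
    maximal c d Acd distinct (c≤i₀ , j≤d) (i≤c , d≤j) with ≤-antisym d≤j j≤d
    ... | refl = gap c (≤∧≢⇒< i≤c λ { refl → 1≢-1 (trans (sym Acd) Aij) })
                       (≤∧≢⇒< c≤i₀ λ { refl → distinct (refl , refl) }) Acd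

module Removal {n : ℕ} {A : Matrix n} {i j i₀ j₀ : Fin n}
  (Aij : A i j ≡ -1ℤ) (west : NearestWest A i j j₀) (south : NearestSouth A i j i₀) where

  Inv : Fin n → Fin n → Set
  Inv = Involved A i j i₀ j₀

  New : Fin n → Fin n → Set
  New = NewOne A i j i₀ j₀

  InRectangle : Fin n → Fin n → Set
  InRectangle x y = i ≤ x × x ≤ i₀ × j₀ ≤ y × y ≤ j

  involved⇒neighbor : ∀ {x y} → Inv x y → Neighbor A i j x y × InRectangle x y
  involved⇒neighbor (inj₁ (refl , refl)) =
    nearestWest⇒neighbor Aij west ,
    ≤-refl , ℕ.<⇒≤ (proj₁ south) , ≤-refl , ℕ.<⇒≤ (proj₁ west)
  involved⇒neighbor (inj₂ (inj₁ (refl , refl))) =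
    nearestSouth⇒neighbor Aij south ,
    ℕ.<⇒≤ (proj₁ south) , ≤-refl , ℕ.<⇒≤ (proj₁ west) , ≤-refl
  involved⇒neighbor (inj₂ (inj₂ neighborInRectangle)) = neighborInRectangle

  neighbor⇒involved : ∀ {x y} → Neighbor A i j x y → x ≤ i₀ → j₀ ≤ y → Inv x y
  neighbor⇒involved nb@(_ , (i≤x , y≤j) , _) x≤i₀ j₀≤y = inj₂ (inj₂ (nb , i≤x , x≤i₀ , j₀≤y , y≤j))

  involved-one : ∀ {x y} → Inv x y → A x y ≡ 1ℤ
  involved-one = proj₁ ∘ proj₁ ∘ involved⇒neighbor

  involved-row<⇒col< : ∀ {a b a′ b′} → Inv a b → Inv a′ b′ → a < a′ → b < b′
  involved-row<⇒col< p q =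
    neighbor-row<⇒col< (proj₁ (involved⇒neighbor p)) (proj₁ (involved⇒neighbor q))

  involved-col<⇒row< : ∀ {a b a′ b′} → Inv a b → Inv a′ b′ → b < b′ → a < a′
  involved-col<⇒row< p q =
    neighbor-col<⇒row< (proj₁ (involved⇒neighbor p)) (proj₁ (involved⇒neighbor q))

  no-one-between : ∀ {x y r c p q} → Inv r y → Inv x c →
    (∀ r′ d → y < d → d < c → ¬ Inv r′ d) →
    A p q ≡ 1ℤ → r ≤ p → p < x → y < q → q ≤ c → ⊥
  no-one-between inv-ry inv-xc gap Apq r≤p p<x y<q q≤c
    with involved⇒neighbor inv-ry | involved⇒neighbor inv-xc
  ... | _ , i≤r , _ , j₀≤y , _ | _ , _ , x≤i₀ , _ , c≤j =
    weaklyNE-neighbor Apq (≤-trans i≤r r≤p , ≤-trans q≤c c≤j) λ (a , b , nb , a≤p , q≤b) →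
      let a<x = ℕ.≤-<-trans a≤p p<x
          y<b = ℕ.<-≤-trans y<q q≤b
          inv-ab = neighbor⇒involved nb (ℕ.<⇒≤ (ℕ.<-≤-trans a<x x≤i₀))
                                        (ℕ.<⇒≤ (ℕ.≤-<-trans j₀≤y y<b))
      in gap a b y<b (involved-row<⇒col< inv-ab inv-xc a<x) inv-ab

  new-ones-no-21 : ∀ {x y x′ y′} → New x y → New x′ y′ → x < x′ → y′ < y → ⊥
  new-ones-no-21 (_ , c , y<c , inv-xc , _) (_ , c′ , y′<c′ , inv-x′c′ , gap′) x<x′ y′<y =
    gap′ _ c (ℕ.<-trans y′<y y<c) (involved-row<⇒col< inv-xc inv-x′c′ x<x′) inv-xc

  new-one-east : ∀ {x y} → New x y → ∃ λ c → y < c × A x c ≡ 1ℤ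
  new-one-east (_ , c , y<c , inv-xc , _) = c , y<c , involved-one inv-xc

  replace-new-below-one : ∀ {x y p q} → New x y → A p q ≡ 1ℤ → p < x → y < q →
    ∃₂ λ x′ y′ → A x′ y′ ≡ 1ℤ × p < x′ × x′ ≤ x × y ≤ y′ × y′ < q
  replace-new-below-one {p = p} {q} ((r , inv-ry) , c , y<c , inv-xc , gap) Apq p<x y<q
    with c <? q | p <? r
  ... | yes c<q | _ = _ , _ , involved-one inv-xc , p<x , ≤-refl , ℕ.<⇒≤ y<c , c<q
  ... | no _ | yes p<r =
    _ , _ , involved-one inv-ry , p<r , ℕ.<⇒≤ (involved-col<⇒row< inv-ry inv-xc y<c) , ≤-refl , y<q
  ... | no c≮q | no p≮r =
    ⊥-elim (no-one-between inv-ry inv-xc gap Apq (ℕ.≮⇒≥ p≮r) p<x y<q (ℕ.≮⇒≥ c≮q))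

  module _ {B : Matrix n} (Bij : B i j ≡ 0ℤ)
    (vanish : ∀ x y → Inv x y → ¬ New x y → B x y ≡ 0ℤ)
    (keep : ∀ x y → ¬ (x ≡ i × y ≡ j) → ¬ Inv x y → ¬ New x y → B x y ≡ A x y) where

    new-or-old : ∀ {x y} → B x y ≡ 1ℤ → ¬ ¬ (New x y ⊎ A x y ≡ 1ℤ)
    new-or-old {x} {y} Bxy = ¬¬-map (λ { (yes new) → inj₁ new ; (no old) → inj₂ (old-one old) })
                                     ¬¬-excluded-middle
      where
      old-one : ¬ New x y → A x y ≡ 1ℤ
      old-one ¬new with (x ≟ i) ×-dec (y ≟ j)
      ... | yes (refl , refl) = ⊥-elim (1≢0 (trans (sym Bxy) Bij))
      ... | no ≢ij = trans (sym (keep x y ≢ij ¬inv ¬new)) Bxy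
        where
        ¬inv : ¬ Inv x y
        ¬inv inv = 1≢0 (trans (sym Bxy) (vanish x y inv ¬new))

    avoids321 : Avoids321 A → Avoids321 B
    avoids321 avoidA (x₁ , x₂ , x₃ , y₁ , y₂ , y₃ , x₁<x₂ , x₂<x₃ , y₁<y₂ , y₂<y₃ , B₁ , B₂ , B₃) =
      new-or-old B₂ [ middle-new , middle-old ]
      where
      middle-new : New x₂ y₂ → ⊥
      middle-new new₂ = new-or-old B₁ [ (λ new₁ → new-ones-no-21 new₁ new₂ x₁<x₂ y₂<y₃) , top-old ]
        where
        top-old : A x₁ y₃ ≡ 1ℤ → ⊥
        top-old A₁ = new-or-old B₃ [ (λ new₃ → new-ones-no-21 new₂ new₃ x₂<x₃ y₁<y₂) , bottom-old ]
          where
          bottom-old : A x₃ y₁ ≡ 1ℤ → ⊥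
          bottom-old A₃ =
            let (x , y , A′ , x₁<x , x≤x₂ , y₂≤y , y<y₃) =
                  replace-new-below-one new₂ A₁ x₁<x₂ y₂<y₃
            in avoidA (x₁ , x , x₃ , y₁ , y , y₃ , x₁<x , ℕ.≤-<-trans x≤x₂ x₂<x₃ ,
                       ℕ.<-≤-trans y₁<y₂ y₂≤y , y<y₃ , A₁ , A′ , A₃)

      middle-old : A x₂ y₂ ≡ 1ℤ → ⊥
      middle-old A₂ =
        one-east-of-top λ (y , y₃≤y , A₁) →
        one-southwest-of-middle λ (x , y′ , x₂<x , y′<y₂ , A₃) →
        avoidA (x₁ , x₂ , x , y′ , y₂ , y , x₁<x₂ , x₂<x , y′<y₂ , ℕ.<-≤-trans y₂<y₃ y₃≤y ,
                A₁ , A₂ , A₃)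
        where
        one-east-of-top : ¬ ¬ ∃ λ y → y₃ ≤ y × A x₁ y ≡ 1ℤ
        one-east-of-top = ¬¬-map [ east-of-new , (λ A₁ → y₃ , ≤-refl , A₁) ] (new-or-old B₁)
          where
          east-of-new : New x₁ y₃ → ∃ λ y → y₃ ≤ y × A x₁ y ≡ 1ℤ
          east-of-new new₁ = let (c , y₃<c , A₁) = new-one-east new₁ in c , ℕ.<⇒≤ y₃<c , A₁

        one-southwest-of-middle : ¬ ¬ ∃₂ λ x y → x₂ < x × y < y₂ × A x y ≡ 1ℤ
        one-southwest-of-middle =
          ¬¬-map [ replaced , (λ A₃ → x₃ , y₁ , x₂<x₃ , y₁<y₂ , A₃) ] (new-or-old B₃)
          where
          replaced : New x₃ y₁ → ∃₂ λ x y → x₂ < x × y < y₂ × A x y ≡ 1ℤ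
          replaced new₃ =
            let (x , y , A₃ , x₂<x , _ , _ , y<y₂) = replace-new-below-one new₃ A₂ x₂<x₃ y₁<y₂
            in x , y , x₂<x , y<y₂ , A₃

swStep-preserves-avoids321 : ∀ {n} {A B : Matrix n} → SWStep A B → Avoids321 A → Avoids321 B
swStep-preserves-avoids321 (_ , _ , _ , _ , (Aij , _) , west , south , Bij , _ , vanish , keep) =
  Removal.avoids321 Aij west south Bij vanish keep

corollary4p4 : ∀ n (A B : Matrix n) → IsASM A → Avoids321 A →
    SWReachable A B → Avoids321 B
corollary4p4 n A B _ avoidA reachable =
  fold (λ C D → Avoids321 C → Avoids321 D) (λ step k → k ∘ swStep-preserves-avoids321 step) id
    reachable avoidA
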